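{- Let $G=(V,E)$ be a strongly connected directed graph and $P=(p_1,\dots,p_\ell)$ a cut path in $G$ of length $\ell-1\ge1$. Then $p_1\in S^+(P)$ and $p_\ell\in S^-(P)$.
   Context: A walk is a sequence of nodes with consecutive pairs being arcs. A subwalk is a contiguous subsequence. A walk $P$ is a cut path if there exist nodes $u,v$ such that every $u$-$v$ walk in $G$ has $P$ as a subwalk. $R^+(P)$ is the set of nodes $x$ such that there is a $p_1$-$x$ walk in $G$ with arc $(p_{\ell-1},p_\ell)$ removed; $R^-(P)$ is the set of nodes $x$ such that there is an $x$-$p_\ell$ walk in $G$ with arc $(p_1,p_2)$ removed. $S^+(P):=R^+(P)\setminus R^-(P)$ and $S^-(P):=R^-(P)\setminus R^+(P)$. -}

module Defs where

open import Data.Nat using (ℕ)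
open import Data.Fin using (Fin)
open import Data.List using (List; []; _∷_; _++_)
open import Data.Product using (Σ; ∃; ∃-syntax; _×_; _,_; proj₁; proj₂)
open import Relation.Nullary using (¬_)
open import Relation.Binary.PropositionalEquality using (_≡_)

Graph : ℕ → Set₁
Graph n = Fin n → Fin n → Set

module _ {n : ℕ} where

  V : Set
  V = Fin n

  data IsWalk (R : Graph n) : V → V → List V → Set where
    single : (x : V) → IsWalk R x x (x ∷ [])
    step   : {x y z : V} {xs : List V} →
             R x y → IsWalk R y z (y ∷ xs) → IsWalk R x z (x ∷ y ∷ xs)

  removeArc : Graph n → V → V → Graph n
  removeArc R a b x y = R x y × ¬ ((x ≡ a) × (y ≡ b))

  Subwalk : List V → List V → Set
  Subwalk P W = ∃[ xs ] ∃[ ys ] (W ≡ xs ++ (P ++ ys))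

  lastArc : V → V → List V → V × V
  lastArc x y []       = x , y
  lastArc x y (z ∷ zs) = lastArc y z zs

  -- Throughout, a path P = (p₁, …, p_ℓ) with ℓ ≥ 2 is given as
  -- p₁ ∷ p₂ ∷ rest.
  pathOf : V → V → List V → List V
  pathOf p₁ p₂ rest = p₁ ∷ p₂ ∷ rest

  endOf : V → V → List V → V
  endOf p₁ p₂ rest = proj₂ (lastArc p₁ p₂ rest)

  penultOf : V → V → List V → V
  penultOf p₁ p₂ rest = proj₁ (lastArc p₁ p₂ rest)

  StronglyConnected : Graph n → Set
  StronglyConnected E = (u v : V) → ∃[ W ] IsWalk E u v W

  IsCutPath : Graph n → List V → Set
  IsCutPath E P =
    (∃[ a ] ∃[ b ] IsWalk E a b P) ×
    (∃[ u ] ∃[ v ] ((W : List V) → IsWalk E u v W → Subwalk P W))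

  R⁺ : Graph n → V → V → List V → V → Set
  R⁺ E p₁ p₂ rest x =
    ∃[ W ] IsWalk (removeArc E (penultOf p₁ p₂ rest) (endOf p₁ p₂ rest)) p₁ x W

  R⁻ : Graph n → V → V → List V → V → Set
  R⁻ E p₁ p₂ rest x =
    ∃[ W ] IsWalk (removeArc E p₁ p₂) x (endOf p₁ p₂ rest) W

  S⁺ : Graph n → V → V → List V → V → Set
  S⁺ E p₁ p₂ rest x = R⁺ E p₁ p₂ rest x × ¬ R⁻ E p₁ p₂ rest x

  S⁻ : Graph n → V → V → List V → V → Set
  S⁻ E p₁ p₂ rest x = R⁻ E p₁ p₂ rest x × ¬ R⁺ E p₁ p₂ rest x

{-# OPTIONS --safe #-}
module Submission where

-- Take a simple u–v walk U. It contains P, say U = X ++ P ++ Y, and replacing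
-- P by any other p₁–p_ℓ walk W gives a u–v walk X ++ W ++ Y, which contains P
-- again. As U is simple, no node of P lies in X or Y, so every arc of P occurs
-- inside W. Hence no p₁–p_ℓ walk avoids the first or the last arc of P: this
-- gives p₁ ∉ R⁻(P) and p_ℓ ∉ R⁺(P), while the trivial walks give p₁ ∈ R⁺(P)
-- and p_ℓ ∈ R⁻(P).

open import Defs
open import Data.Nat using (ℕ)
open import Data.Fin using (Fin)
open import Data.Fin.Properties using (_≟_)
open import Data.List using (List; []; _∷_; _++_)
open import Data.List.Properties using (∷-injective; ++-assoc)
open import Data.List.Membership.Propositional using (_∈_; _∉_)
open import Data.List.Membership.Propositional.Properties using (∈-++⁺ˡ; ∈-++⁺ʳ)
open import Data.List.Relation.Unary.Any using (here; there; any?)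
open import Data.List.Relation.Unary.All as All using ()
open import Data.List.Relation.Unary.All.Properties using (¬Any⇒All¬)
open import Data.List.Relation.Unary.Unique.Propositional using (Unique; []; _∷_)
open import Data.List.Relation.Unary.Unique.Propositional.Properties
  using (Unique[x∷xs]⇒x∉xs)
open import Data.Product using (_×_; _,_; proj₁; proj₂; ∃-syntax)
open import Data.Empty using (⊥-elim)
open import Function using (_∘_)
open import Relation.Nullary using (¬_; yes; no)
open import Relation.Binary.PropositionalEquality
  using (_≡_; refl; sym; cong; module ≡-Reasoning)

private
  variable
    n : ℕ
    R S : Graph n
    a b c u v x y z : Fin n
    P W X Y : List (Fin n)

unique-++-disjoint : ∀ (A : List (Fin n)) {B} → Unique (A ++ B) → x ∈ A → x ∉ B
unique-++-disjoint (_ ∷ A) uniq (here refl) x∈B =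
  Unique[x∷xs]⇒x∉xs uniq (∈-++⁺ʳ A x∈B)
unique-++-disjoint (_ ∷ A) (_ ∷ uniq) (there x∈A) = unique-++-disjoint A uniq x∈A

unique-++⁻ʳ : ∀ (A : List (Fin n)) {B} → Unique (A ++ B) → Unique B
unique-++⁻ʳ []      uniq       = uniq
unique-++⁻ʳ (_ ∷ A) (_ ∷ uniq) = unique-++⁻ʳ A uniq

walk-head : IsWalk R a b (x ∷ W) → a ≡ x
walk-head (single _) = refl
walk-head (step _ _) = refl

walk-end : ∀ x y rest → IsWalk R a b (pathOf x y rest) → b ≡ endOf x y rest
walk-end x y []         (step _ (single _)) = refl
walk-end x y (z ∷ rest) (step _ w)          = walk-end y z rest w

walk-map : (∀ {x y} → R x y → S x y) → IsWalk R a b W → IsWalk S a b W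
walk-map f (single x) = single x
walk-map f (step r w) = step (f r) (walk-map f w)

walk-∷ : R x y → IsWalk R y z W → IsWalk R x z (x ∷ W)
walk-∷ r (single _)   = step r (single _)
walk-∷ r (step r′ w) = step r (step r′ w)

walk-++ : IsWalk R a b W → IsWalk R b c (b ∷ Y) → IsWalk R a c (W ++ Y)
walk-++ (single _) w′ = w′
walk-++ (step r w) w′ = step r (walk-++ w w′)

walk-dropPrefix : IsWalk R a b P → IsWalk R a c (P ++ Y) → IsWalk R b c (b ∷ Y)
walk-dropPrefix (single _) w′          = w′
walk-dropPrefix (step _ w) (step _ w′) = walk-dropPrefix w w′

walk-splitAt : ∀ X t Z → IsWalk R u v (X ++ t ∷ Z) →
               IsWalk R t v (t ∷ Z) × (∀ Z′ → IsWalk R t v Z′ → IsWalk R u v (X ++ Z′))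
walk-splitAt [] t Z w with walk-head w
... | refl = w , λ _ w′ → w′
walk-splitAt (_ ∷ []) t Z (step r w) = w , λ _ w′ → walk-∷ r w′
walk-splitAt (_ ∷ d ∷ X) t Z (step r w) with walk-splitAt (d ∷ X) t Z w
... | tail , replace = tail , λ Z′ w′ → step r (replace Z′ w′)

walk-replaceInfix : ∀ X → IsWalk R u v (X ++ P ++ Y) → IsWalk R a b P →
                    IsWalk R a b W → IsWalk R u v (X ++ W ++ Y)
walk-replaceInfix {P = p ∷ P} {Y = Y} {W = W} X wU wP wW with walk-head wP
... | refl with walk-splitAt X p (P ++ Y) wU
...   | tail , replace = replace (W ++ Y) (walk-++ wW (walk-dropPrefix wP tail))

walk-suffixFrom : IsWalk R a v W → Unique W → x ∈ W →
                  ∃[ W′ ] IsWalk R x v W′ × Unique W′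
walk-suffixFrom (single _) uniq       (here refl)  = _ , single _ , uniq
walk-suffixFrom (step r w) uniq       (here refl)  = _ , step r w , uniq
walk-suffixFrom (step _ w) (_ ∷ uniq) (there x∈W) = walk-suffixFrom w uniq x∈W

walk-simplify : IsWalk R u v W → ∃[ W′ ] IsWalk R u v W′ × Unique W′
walk-simplify (single x) = _ , single x , (All.[] ∷ [])
walk-simplify (step {x} r w) with walk-simplify w
... | W′ , w′ , uniq with any? (x ≟_) W′
...   | yes x∈W′ = walk-suffixFrom w′ uniq x∈W′
...   | no  x∉W′ = x ∷ W′ , walk-∷ r w′ , (¬Any⇒All¬ W′ x∉W′ ∷ uniq)

subwalk-trans : Subwalk P X → Subwalk X W → Subwalk P W
subwalk-trans {P = P} (xs , ys , refl) (X , Y , refl) = X ++ xs , ys ++ Y , (begin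
  X ++ ((xs ++ (P ++ ys)) ++ Y)   ≡⟨ cong (X ++_) (++-assoc xs (P ++ ys) Y) ⟩
  X ++ (xs ++ ((P ++ ys) ++ Y))   ≡⟨ cong (λ Z → X ++ (xs ++ Z)) (++-assoc P ys Y) ⟩
  X ++ (xs ++ (P ++ (ys ++ Y)))   ≡⟨ sym (++-assoc X xs _) ⟩
  (X ++ xs) ++ (P ++ (ys ++ Y))   ∎)
  where open ≡-Reasoning

Traverses : List (Fin n) → Fin n → Fin n → Set
Traverses W x y = Subwalk (x ∷ y ∷ []) W

traverses-∈ˡ : Traverses W x y → x ∈ W
traverses-∈ˡ (xs , _ , refl) = ∈-++⁺ʳ xs (here refl)

traverses-∈ʳ : Traverses W x y → y ∈ W
traverses-∈ʳ (xs , _ , refl) = ∈-++⁺ʳ xs (there (here refl))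

traverses-arc : IsWalk R a b W → Traverses W x y → R x y
traverses-arc (single _) ([] , _ , ())
traverses-arc (single _) (_ ∷ [] , _ , ())
traverses-arc (single _) (_ ∷ _ ∷ _ , _ , ())
traverses-arc (step r _) ([] , _ , refl) = r
traverses-arc (step _ w) (_ ∷ xs , ys , eq) =
  traverses-arc w (xs , ys , proj₂ (∷-injective eq))

traverses-++⁻ʳ : ∀ X → Traverses (X ++ W) x y → x ∉ X → Traverses W x y
traverses-++⁻ʳ []      t x∉X = t
traverses-++⁻ʳ (_ ∷ X) ([] , _ , eq) x∉X =
  ⊥-elim (x∉X (here (sym (proj₁ (∷-injective eq)))))
traverses-++⁻ʳ (_ ∷ X) (_ ∷ xs , ys , eq) x∉X =
  traverses-++⁻ʳ X (xs , ys , proj₂ (∷-injective eq)) (x∉X ∘ there)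

traverses-++⁻ˡ : ∀ W → Traverses (W ++ Y) x y → y ∉ Y → Traverses W x y
traverses-++⁻ˡ []           t               y∉Y = ⊥-elim (y∉Y (traverses-∈ʳ t))
traverses-++⁻ˡ (_ ∷ [])     ([] , _ , refl) y∉Y = ⊥-elim (y∉Y (here refl))
traverses-++⁻ˡ (_ ∷ _ ∷ W) ([] , _ , refl) y∉Y = [] , W , refl
traverses-++⁻ˡ (w ∷ W) (_ ∷ xs , ys , eq) y∉Y
  with traverses-++⁻ˡ W (xs , ys , proj₂ (∷-injective eq)) y∉Y
... | xs′ , ys′ , eq′ = w ∷ xs′ , ys′ , cong (w ∷_) eq′

traverses-lastArc : ∀ (x y : Fin n) rest →
                    Traverses (pathOf x y rest) (penultOf x y rest) (endOf x y rest)
traverses-lastArc x y []         = [] , [] , refl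
traverses-lastArc x y (z ∷ rest) with traverses-lastArc y z rest
... | xs , ys , eq = x ∷ xs , ys , cong (x ∷_) eq

cutPath-arcs-unavoidable :
  IsWalk R a b P → (∀ U → IsWalk R u v U → Subwalk P U) → ∃[ U ] IsWalk R u v U →
  IsWalk R a b W → Traverses P x y → Traverses W x y
cutPath-arcs-unavoidable {P = P} {W = W} {x = x} {y = y} wP cut (_ , wU₀) wW arc
  with walk-simplify wU₀
... | U , wU , uniq with cut U wU
...   | X , Y , refl = traverses-++⁻ˡ W (traverses-++⁻ʳ X inReplaced x∉X) y∉Y
  where
  inReplaced : Traverses (X ++ W ++ Y) x y
  inReplaced = subwalk-trans arc (cut _ (walk-replaceInfix X wU wP wW))
  x∉X : x ∉ X
  x∉X x∈X = unique-++-disjoint X uniq x∈X (∈-++⁺ˡ (traverses-∈ˡ arc))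
  y∉Y : y ∉ Y
  y∉Y = unique-++-disjoint P (unique-++⁻ʳ X uniq) (traverses-∈ʳ arc)

lemma15 : (n : ℕ) (E : Graph n) → StronglyConnected E →
          (p₁ p₂ : Fin n) (rest : List (Fin n)) →
          IsCutPath E (pathOf p₁ p₂ rest) →
          S⁺ E p₁ p₂ rest p₁ × S⁻ E p₁ p₂ rest (endOf p₁ p₂ rest)
lemma15 n E sc p₁ p₂ rest ((a , b , wP) , (u , v , cut))
  with walk-head wP | walk-end p₁ p₂ rest wP
... | refl | refl =
  ((_ , single p₁) , noWalkAvoiding ([] , rest , refl)) ,
  ((_ , single _)  , noWalkAvoiding (traverses-lastArc p₁ p₂ rest))
  where
  noWalkAvoiding : ∀ {x y} → Traverses (pathOf p₁ p₂ rest) x y →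
                   ¬ (∃[ W ] IsWalk (removeArc E x y) p₁ (endOf p₁ p₂ rest) W)
  noWalkAvoiding arc (_ , w) =
    proj₂ (traverses-arc w (cutPath-arcs-unavoidable wP cut (sc u v) (walk-map proj₁ w) arc))
          (refl , refl)
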